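{- Let $G=(V,E)$ be a finite, simple graph that is connected but not complete, with $n=|V|>2$. Then $\beta_1(G)<n-1$.
   Context: For a graph $G=(V,E)$ with geodesic (shortest-path) distance $d$, and an integer $k\ge 0$, define $d_k(u,v):=\min\{d(u,v),k+1\}$. A non-empty set $R\subseteq V$ is a $k$-truncated resolving set of $G$ if for all $u,v\in V$, $d_k(u,r)=d_k(v,r)$ for every $r\in R$ implies $u=v$. The $k$-truncated metric dimension $\beta_k(G)$ is the minimum size of a $k$-truncated resolving set of $G$; in particular $\beta_1(G)$ is the case $k=1$. -}

module Defs where

open import Data.Nat using (ℕ; zero; suc)
open import Data.Bool using (Bool; true; false; _∧_; if_then_else_)
open import Data.Fin using (Fin)
open import Data.Fin.Properties using (_≟_)
open import Data.List using (allFin)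
open import Data.Bool.ListAction using (any)
open import Data.Fin.Subset using (Subset; _∈_; Nonempty)
open import Data.Product using (∃; ∃₂; _×_)
open import Relation.Binary.PropositionalEquality using (_≡_; _≢_)
open import Relation.Nullary.Decidable using (⌊_⌋)

record SimpleGraph (n : ℕ) : Set where
  field
    adj       : Fin n → Fin n → Bool
    adj-sym   : ∀ u v → adj u v ≡ adj v u
    adj-irrefl : ∀ v → adj v v ≡ false
open SimpleGraph public

walkTo : ∀ {n} → SimpleGraph n → ℕ → Fin n → Fin n → Bool
walkTo G zero    u v = ⌊ u ≟ v ⌋
walkTo G (suc m) u v = any (λ w → adj G u w ∧ walkTo G m w v) (allFin _)

-- search p k = least i ≤ k with p i = true, or k + 1 if there is none.
search : (ℕ → Bool) → ℕ → ℕ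
search p zero    = if p zero then zero else suc zero
search p (suc k) = if p zero then zero else suc (search (λ i → p (suc i)) k)

-- Truncated geodesic distance d_k(u,v) = min{ d(u,v), k+1 }.
-- (d(u,v) is the least length of a walk from u to v; infinite if none.)
dTrunc : ∀ {n} → SimpleGraph n → ℕ → Fin n → Fin n → ℕ
dTrunc G k u v = search (λ m → walkTo G m u v) k

Connected : ∀ {n} → SimpleGraph n → Set
Connected G = ∀ u v → ∃ λ m → walkTo G m u v ≡ true

Complete : ∀ {n} → SimpleGraph n → Set
Complete G = ∀ u v → u ≢ v → adj G u v ≡ true

IsTruncResolving : ∀ {n} → SimpleGraph n → ℕ → Subset n → Set
IsTruncResolving {n} G k R =
  Nonempty R ×
  (∀ (u v : Fin n) → (∀ r → r ∈ R → dTrunc G k u r ≡ dTrunc G k v r) → u ≡ v)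

-- Pick non-adjacent vertices u ≠ v and, by connectivity, a neighbour w of u.
-- Every vertex other than w and v is resolved by itself, being the only vertex
-- at distance 0 from it, while u separates w and v (d₁(w,u) = 1, d₁(v,u) = 2).
-- So V ∖ {w, v}, of size n − 2, is a 1-truncated resolving set.
module Submission where

open import Defs
open import Data.Nat using (ℕ; zero; suc; _<_; _∸_)
open import Data.Nat.Properties using (∸-monoʳ-<)
open import Data.Bool as Bool using (Bool; true; false; _∧_)
open import Data.Bool.Properties using (T-≡; ⇔→≡; ∧-conicalˡ; ∧-conicalʳ; ¬-not)
open import Data.Fin using (Fin)
open import Data.Fin.Properties using (_≟_; all?; ¬∀⟶∃¬)
open import Data.Fin.Subset using (Subset; ∣_∣; ⁅_⁆; _∪_; ∁; _∈_; _∉_; _⊂_)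
open import Data.Fin.Subset.Properties
  using (_∈?_; ∣∁p∣≡n∸∣p∣; ∣p∣≤n; p⊂q⇒∣p∣<∣q∣; p⊆p∪q; q⊆p∪q; x∈⁅x⁆; x≢y⇒x∉⁅y⁆;
         x∈⁅y⁆⇒x≡y; x∈p∪q⁻; x∉∁p⇒x∈p; x∉p⇒x∈∁p; ∣⁅x⁆∣≡1)
open import Data.List using (allFin)
open import Data.List.Membership.Propositional using (lose)
open import Data.List.Membership.Propositional.Properties using (∈-allFin)
open import Data.List.Relation.Unary.Any using (satisfied)
open import Data.List.Relation.Unary.Any.Properties using (any⁺; any⁻)
open import Data.Product using (∃; ∃₂; _×_; _,_)
open import Data.Sum as Sum using (_⊎_; inj₁; inj₂; [_,_])
open import Function using (const; _∘_)
open import Function.Bundles using (Equivalence; mk⇔)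
open import Relation.Nullary using (¬_; Dec; yes; no; contradiction)
open import Relation.Nullary.Decidable using (isYes≗does; dec-false; toWitness; fromWitness; ¬?; _→-dec_)
open import Relation.Binary.PropositionalEquality
  using (_≡_; _≢_; refl; sym; trans; cong; cong₂; subst; ≢-sym; module ≡-Reasoning)

open Equivalence using (to; from)

∈∁pair : ∀ {n} {x w v : Fin n} → x ≢ w → x ≢ v → x ∈ ∁ (⁅ w ⁆ ∪ ⁅ v ⁆)
∈∁pair x≢w x≢v = x∉p⇒x∈∁p ([ x≢y⇒x∉⁅y⁆ x≢w , x≢y⇒x∉⁅y⁆ x≢v ] ∘ x∈p∪q⁻ _ _)

∉∁pair : ∀ {n} {x w v : Fin n} → x ∉ ∁ (⁅ w ⁆ ∪ ⁅ v ⁆) → x ≡ w ⊎ x ≡ v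
∉∁pair {w = w} {v} x∉ = Sum.map (x∈⁅y⁆⇒x≡y w) (x∈⁅y⁆⇒x≡y v) (x∈p∪q⁻ _ _ (x∉∁p⇒x∈p x∉))

∣∁pair∣<n∸1 : ∀ {n} {w v : Fin n} → w ≢ v → ∣ ∁ (⁅ w ⁆ ∪ ⁅ v ⁆) ∣ < n ∸ 1
∣∁pair∣<n∸1 {n} {w} {v} w≢v =
  subst (_< n ∸ 1) (sym (∣∁p∣≡n∸∣p∣ (⁅ w ⁆ ∪ ⁅ v ⁆))) (∸-monoʳ-< 1<∣pair∣ (∣p∣≤n (⁅ w ⁆ ∪ ⁅ v ⁆)))
  where
  ⁅w⁆⊂pair : ⁅ w ⁆ ⊂ ⁅ w ⁆ ∪ ⁅ v ⁆
  ⁅w⁆⊂pair = p⊆p∪q _ , v , q⊆p∪q _ _ (x∈⁅x⁆ v) , x≢y⇒x∉⁅y⁆ (≢-sym w≢v)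

  1<∣pair∣ : 1 < ∣ ⁅ w ⁆ ∪ ⁅ v ⁆ ∣
  1<∣pair∣ = subst (_< ∣ ⁅ w ⁆ ∪ ⁅ v ⁆ ∣) (∣⁅x⁆∣≡1 w) (p⊂q⇒∣p∣<∣q∣ ⁅w⁆⊂pair)

search-hit : ∀ (p : ℕ → Bool) k → p 0 ≡ true → search p k ≡ 0
search-hit p zero    p0 rewrite p0 = refl
search-hit p (suc k) p0 rewrite p0 = refl

search≡0⇒hit : ∀ (p : ℕ → Bool) k → search p k ≡ 0 → p 0 ≡ true
search≡0⇒hit p zero    s≡0 with p 0
... | true = refl
search≡0⇒hit p (suc k) s≡0 with p 0
... | true = refl

search-miss : ∀ (p : ℕ → Bool) k → p 0 ≡ false → search p (suc k) ≡ suc (search (p ∘ suc) k)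
search-miss p k p0 rewrite p0 = refl

search-none : ∀ (p : ℕ → Bool) → p 0 ≡ false → search p 0 ≡ 1
search-none p p0 rewrite p0 = refl

SameProfile : ∀ {n} → SimpleGraph n → ℕ → Subset n → Fin n → Fin n → Set
SameProfile G k R x y = ∀ r → r ∈ R → dTrunc G k x r ≡ dTrunc G k y r

module _ {n : ℕ} (G : SimpleGraph n) where

  walkTo-zero⁻ : ∀ {u v} → walkTo G 0 u v ≡ true → u ≡ v
  walkTo-zero⁻ {u} {v} e = toWitness {a? = u ≟ v} (from T-≡ e)

  walkTo-zero-refl : ∀ u → walkTo G 0 u u ≡ true
  walkTo-zero-refl u = to T-≡ (fromWitness {a? = u ≟ u} refl)

  walkTo-zero-≢ : ∀ {u v} → u ≢ v → walkTo G 0 u v ≡ false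
  walkTo-zero-≢ {u} {v} u≢v = trans (isYes≗does (u ≟ v)) (dec-false (u ≟ v) u≢v)

  walkTo-suc⁺ : ∀ m {u w v} → adj G u w ≡ true → walkTo G m w v ≡ true →
                walkTo G (suc m) u v ≡ true
  walkTo-suc⁺ m {w = w} uw wv =
    to T-≡ (any⁺ _ (lose (∈-allFin w) (from T-≡ (cong₂ _∧_ uw wv))))

  walkTo-suc⁻ : ∀ m {u v} → walkTo G (suc m) u v ≡ true →
                ∃ λ w → adj G u w ≡ true × walkTo G m w v ≡ true
  walkTo-suc⁻ m {u} {v} e with satisfied (any⁻ _ (allFin n) (from T-≡ e))
  ... | w , step = w , ∧-conicalˡ (adj G u w) (walkTo G m w v) (to T-≡ step)
                     , ∧-conicalʳ (adj G u w) (walkTo G m w v) (to T-≡ step)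

  walkTo-one : ∀ u v → walkTo G 1 u v ≡ adj G u v
  walkTo-one u v = ⇔→≡ (mk⇔ walk⇒adj (λ uv → walkTo-suc⁺ 0 uv (walkTo-zero-refl v)))
    where
    walk⇒adj : walkTo G 1 u v ≡ true → adj G u v ≡ true
    walk⇒adj e with walkTo-suc⁻ 0 e
    ... | w , uw , wv = subst (λ x → adj G u x ≡ true) (walkTo-zero⁻ {w} {v} wv) uw

  dTrunc-self : ∀ k a → dTrunc G k a a ≡ 0
  dTrunc-self k a = search-hit (λ m → walkTo G m a a) k (walkTo-zero-refl a)

  dTrunc≡0⇒≡ : ∀ k a b → dTrunc G k a b ≡ 0 → a ≡ b
  dTrunc≡0⇒≡ k a b d≡0 = walkTo-zero⁻ (search≡0⇒hit (λ m → walkTo G m a b) k d≡0)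

  dTrunc-adjacent : ∀ k {a b} → a ≢ b → adj G a b ≡ true → dTrunc G (suc k) a b ≡ 1
  dTrunc-adjacent k {a} {b} a≢b ab = begin
    dTrunc G (suc k) a b                                ≡⟨ search-miss (λ m → walkTo G m a b) k (walkTo-zero-≢ a≢b) ⟩
    suc (search (λ m → walkTo G (suc m) a b) k)         ≡⟨ cong suc (search-hit (λ m → walkTo G (suc m) a b) k (trans (walkTo-one a b) ab)) ⟩
    1                                                   ∎
    where open ≡-Reasoning

  dTrunc₁-nonadjacent : ∀ {a b} → a ≢ b → adj G a b ≡ false → dTrunc G 1 a b ≡ 2
  dTrunc₁-nonadjacent {a} {b} a≢b ab = begin
    dTrunc G 1 a b                                      ≡⟨ search-miss (λ m → walkTo G m a b) 0 (walkTo-zero-≢ a≢b) ⟩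
    suc (search (λ m → walkTo G (suc m) a b) 0)         ≡⟨ cong suc (search-none (λ m → walkTo G (suc m) a b) (trans (walkTo-one a b) ab)) ⟩
    2                                                   ∎
    where open ≡-Reasoning

  edge-if-distinct? : ∀ u v → Dec (u ≢ v → adj G u v ≡ true)
  edge-if-distinct? u v = ¬? (u ≟ v) →-dec (adj G u v Bool.≟ true)

  nonadjacent-pair : ¬ Complete G → ∃₂ λ u v → u ≢ v × adj G u v ≡ false
  nonadjacent-pair ¬complete
    with ¬∀⟶∃¬ n _ (λ u → all? (edge-if-distinct? u)) ¬complete
  ... | u , ¬∀v with ¬∀⟶∃¬ n _ (edge-if-distinct? u) ¬∀v
  ... | v , ¬edge =
    u , v , (λ u≡v → ¬edge (contradiction u≡v)) , ¬-not (¬edge ∘ const)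

  neighbour : Connected G → ∀ {u v} → u ≢ v → ∃ λ w → adj G u w ≡ true
  neighbour connected {u} {v} u≢v with connected u v
  ... | zero  , walk = contradiction (walkTo-zero⁻ walk) u≢v
  ... | suc m , walk with walkTo-suc⁻ m walk
  ... | w , uw , _ = w , uw

  adjacent⇒≢ : ∀ {u w} → adj G u w ≡ true → u ≢ w
  adjacent⇒≢ {u} uw refl = contradiction (trans (sym uw) (adj-irrefl G u)) λ ()

  neighbour≢non-neighbour : ∀ {u w v} → adj G u w ≡ true → adj G u v ≡ false → w ≢ v
  neighbour≢non-neighbour uw uv refl = contradiction (trans (sym uw) uv) λ ()

  dTrunc₁-separates : ∀ {u v w} → u ≢ v → adj G u w ≡ true → adj G u v ≡ false →
                      dTrunc G 1 w u ≢ dTrunc G 1 v u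
  dTrunc₁-separates {u} {v} {w} u≢v uw uv same = contradiction 1≡2 λ ()
    where
    open ≡-Reasoning
    1≡2 : 1 ≡ 2
    1≡2 = begin
      1               ≡⟨ sym (dTrunc-adjacent 0 (≢-sym (adjacent⇒≢ uw)) (trans (adj-sym G w u) uw)) ⟩
      dTrunc G 1 w u  ≡⟨ same ⟩
      dTrunc G 1 v u  ≡⟨ dTrunc₁-nonadjacent (≢-sym u≢v) (trans (adj-sym G v u) uv) ⟩
      2               ∎

  member-resolved : ∀ k {R x y} → x ∈ R → SameProfile G k R x y → x ≡ y
  member-resolved k {x = x} {y} x∈R same =
    sym (dTrunc≡0⇒≡ k y x (trans (sym (same x x∈R)) (dTrunc-self k x)))

  ∁pair-resolving : ∀ k {w v r} → r ∈ ∁ (⁅ w ⁆ ∪ ⁅ v ⁆) → dTrunc G k w r ≢ dTrunc G k v r →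
                    IsTruncResolving G k (∁ (⁅ w ⁆ ∪ ⁅ v ⁆))
  ∁pair-resolving k {w} {v} {r} r∈R separates = (r , r∈R) , resolves
    where
    R = ∁ (⁅ w ⁆ ∪ ⁅ v ⁆)

    pair-resolved : ∀ {x y} → x ≡ w ⊎ x ≡ v → y ≡ w ⊎ y ≡ v → SameProfile G k R x y → x ≡ y
    pair-resolved (inj₁ refl) (inj₁ refl) _    = refl
    pair-resolved (inj₂ refl) (inj₂ refl) _    = refl
    pair-resolved (inj₁ refl) (inj₂ refl) same = contradiction (same r r∈R) separates
    pair-resolved (inj₂ refl) (inj₁ refl) same = contradiction (sym (same r r∈R)) separates

    resolves : ∀ x y → SameProfile G k R x y → x ≡ y
    resolves x y same with x ∈? R | y ∈? R
    ... | yes x∈R | _       = member-resolved k x∈R same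
    ... | _       | yes y∈R = sym (member-resolved k y∈R (λ r r∈R → sym (same r r∈R)))
    ... | no x∉R  | no y∉R  = pair-resolved (∉∁pair x∉R) (∉∁pair y∉R) same

lemma2 : (n : ℕ) → 2 < n → (G : SimpleGraph n) → Connected G → ¬ Complete G →
         ∃ λ (R : Subset n) → IsTruncResolving G 1 R × ∣ R ∣ < n ∸ 1
lemma2 n _ G connected ¬complete with nonadjacent-pair G ¬complete
... | u , v , u≢v , uv with neighbour G connected u≢v
... | w , uw =
  ∁ (⁅ w ⁆ ∪ ⁅ v ⁆) ,
  ∁pair-resolving G 1 (∈∁pair (adjacent⇒≢ G uw) u≢v) (dTrunc₁-separates G u≢v uw uv) ,
  ∣∁pair∣<n∸1 (neighbour≢non-neighbour G uw uv)
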